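{- Let $D$ be a non-trivial strongly connected digraph. (a) The following are equivalent: (i) $D=\overleftrightarrow{K}_n$ for some $n\ge 2$; (ii) $\mathrm{diam}(D)=1$; (iii) $\overrightarrow{srvc}(D)=0$; (iv) $\overrightarrow{rvc}(D)=0$; (v) $\overrightarrow{src}(D)=1$; (vi) $\overrightarrow{rc}(D)=1$. (b) (i) $\overrightarrow{srvc}(D)=1$ if and only if $\overrightarrow{rvc}(D)=1$, if and only if $\mathrm{diam}(D)=2$. (ii) $\overrightarrow{srvc}(D)=2$ if and only if $\overrightarrow{rvc}(D)=2$. (iii) $\overrightarrow{src}(D)=2$ if and only if $\overrightarrow{rc}(D)=2$. Moreover, either of the conditions in (b)(iii) implies each of the conditions in (b)(i).
   Context: All digraphs are finite and simple; non-trivial means at least two vertices. A (directed) path is a sequence of distinct vertices $x_0,\dots,x_\ell$ with each $x_{i-1}x_i$ an arc; its length is $\ell$. A digraph is strongly connected if for every ordered pair $(u,v)$ there is a $u$–$v$ path; $d(u,v)$ is the length of a shortest $u$–$v$ path (a $u$–$v$ geodesic), and $\mathrm{diam}(D)=\max d(u,v)$. $\overleftrightarrow{K}_n$ is the complete digraph on $n$ vertices (all ordered pairs of distinct vertices are arcs). In a vertex-coloured digraph, a path is (vertex-)rainbow if its internal vertices have pairwise distinct colours; in an arc-coloured digraph, a path is rainbow if its arcs have pairwise distinct colours. A vertex-colouring of $D$ is rainbow vertex-connected if every ordered pair $(u,v)$ is joined by a rainbow $u$–$v$ path, and strongly rainbow vertex-connected if every ordered pair is joined by a rainbow $u$–$v$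 geodesic; $\overrightarrow{rvc}(D)$, $\overrightarrow{srvc}(D)$ denote the minimum numbers of colours in such colourings (taken to be $0$ when no internal vertices ever need colouring, i.e. when every ordered pair of distinct vertices is an arc). Analogously, an arc-colouring is rainbow connected (resp. strongly rainbow connected) if every ordered pair $(u,v)$ is joined by an arc-rainbow $u$–$v$ path (resp. geodesic); $\overrightarrow{rc}(D)$, $\overrightarrow{src}(D)$ are the minimum numbers of colours in such arc-colourings. -}

module Defs where

open import Data.Nat using (ℕ; zero; suc; _≤_; _∸_)
open import Data.Fin using (Fin)
open import Data.Bool using (Bool; true; false)
open import Data.List using (List; []; _∷_; length; map)
open import Data.List.Relation.Unary.Unique.Propositional using (Unique)
open import Data.Product using (Σ; ∃; ∃-syntax; _×_; _,_; uncurry)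
open import Data.Sum using (_⊎_)
open import Relation.Binary.PropositionalEquality using (_≡_; _≢_)

-- A finite simple digraph on vertex set Fin n: loopless adjacency relation
-- (given by a Boolean matrix, so no multiple arcs).
record Digraph (n : ℕ) : Set where
  field
    adj      : Fin n → Fin n → Bool
    loopless : ∀ x → adj x x ≡ false

Arc : ∀ {n} → Digraph n → Fin n → Fin n → Set
Arc D u v = Digraph.adj D u v ≡ true

data IsWalk {n : ℕ} (D : Digraph n) : Fin n → Fin n → List (Fin n) → Set where
  here : ∀ {u} → IsWalk D u u (u ∷ [])
  step : ∀ {u w v xs} → Arc D u w → IsWalk D w v xs → IsWalk D u v (u ∷ xs)

IsPath : ∀ {n} → Digraph n → Fin n → Fin n → List (Fin n) → Set
IsPath D u v xs = IsWalk D u v xs × Unique xs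

len : ∀ {A : Set} → List A → ℕ
len xs = length xs ∸ 1

dropLast : ∀ {A : Set} → List A → List A
dropLast [] = []
dropLast (x ∷ []) = []
dropLast (x ∷ y ∷ ys) = x ∷ dropLast (y ∷ ys)

internal : ∀ {A : Set} → List A → List A
internal [] = []
internal (x ∷ xs) = dropLast xs

arcsOf : ∀ {A : Set} → List A → List (A × A)
arcsOf [] = []
arcsOf (x ∷ []) = []
arcsOf (x ∷ y ∷ ys) = (x , y) ∷ arcsOf (y ∷ ys)

IsLeast : (ℕ → Set) → ℕ → Set
IsLeast P k = P k × (∀ j → P j → k ≤ j)

HasPathOfLength : ∀ {n} → Digraph n → Fin n → Fin n → ℕ → Set
HasPathOfLength D u v ℓ = ∃[ xs ] (IsPath D u v xs × len xs ≡ ℓ)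

Dist : ∀ {n} → Digraph n → Fin n → Fin n → ℕ → Set
Dist D u v ℓ = IsLeast (HasPathOfLength D u v) ℓ

IsGeodesic : ∀ {n} → Digraph n → Fin n → Fin n → List (Fin n) → Set
IsGeodesic D u v xs = IsPath D u v xs × (∀ ys → IsPath D u v ys → len xs ≤ len ys)

StronglyConnected : ∀ {n} → Digraph n → Set
StronglyConnected D = ∀ u v → ∃[ xs ] IsPath D u v xs

Diam : ∀ {n} → Digraph n → ℕ → Set
Diam {n} D m =
  (∀ (u v : Fin n) → Σ ℕ λ ℓ → Dist D u v ℓ × ℓ ≤ m)
  × (Σ (Fin n) λ u → Σ (Fin n) λ v → Dist D u v m)

IsComplete : ∀ {n} → Digraph n → Set
IsComplete {n} D = ∀ (u v : Fin n) → u ≢ v → Arc D u v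

VRainbow : ∀ {n k} → (Fin n → Fin k) → List (Fin n) → Set
VRainbow c xs = Unique (map c (internal xs))

-- arc-rainbow: arcs get pairwise distinct colours
-- (an arc-colouring is c : Fin n → Fin n → Fin k; only its values on arcs matter)
ARainbow : ∀ {n k} → (Fin n → Fin n → Fin k) → List (Fin n) → Set
ARainbow c xs = Unique (map (uncurry c) (arcsOf xs))

-- D admits a rainbow vertex-connected colouring with k colours
-- (with the convention that 0 colours suffice iff every ordered pair of
--  distinct vertices is an arc)
RVColourable : ∀ {n} → Digraph n → ℕ → Set
RVColourable {n} D k =
  (k ≡ 0 × IsComplete D)
  ⊎ (Σ (Fin n → Fin k) λ c → ∀ u v → ∃[ xs ] (IsPath D u v xs × VRainbow c xs))

SRVColourable : ∀ {n} → Digraph n → ℕ → Set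
SRVColourable {n} D k =
  (k ≡ 0 × IsComplete D)
  ⊎ (Σ (Fin n → Fin k) λ c → ∀ u v → ∃[ xs ] (IsGeodesic D u v xs × VRainbow c xs))

RColourable : ∀ {n} → Digraph n → ℕ → Set
RColourable {n} D k =
  Σ (Fin n → Fin n → Fin k) λ c → ∀ u v → ∃[ xs ] (IsPath D u v xs × ARainbow c xs)

SRColourable : ∀ {n} → Digraph n → ℕ → Set
SRColourable {n} D k =
  Σ (Fin n → Fin n → Fin k) λ c → ∀ u v → ∃[ xs ] (IsGeodesic D u v xs × ARainbow c xs)

RVC SRVC RC SRC : ∀ {n} → Digraph n → ℕ → Set
RVC D k = IsLeast (RVColourable D) k
SRVC D k = IsLeast (SRVColourable D) k
RC D k = IsLeast (RColourable D) k
SRC D k = IsLeast (SRColourable D) k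

module Submission where

open import Defs
open import Data.Nat using (ℕ; zero; suc; _≤_; _<_; z≤n; s≤s; _≤?_)
open import Data.Nat.Properties using (≤-trans; ≤-refl; ≤-antisym; ≤-total; ≤-pred; ≰⇒>; <-≤-trans; n≤1+n; 1+n≰n)
open import Data.Fin using (Fin; zero; suc; _≟_)
open import Data.Fin.Properties using (any?; injective⇒≤)
open import Data.Bool using (true)
import Data.Bool.Properties as Bool
open import Data.List using (List; []; _∷_; length; lookup)
open import Data.List.Properties using (length-map)
import Data.List.Relation.Unary.All as All
open import Data.List.Relation.Unary.All using ([]; _∷_)
open import Data.List.Relation.Unary.AllPairs using ([]; _∷_)
open import Data.List.Relation.Unary.Unique.Propositional using (Unique)
open import Data.List.Membership.Propositional.Properties using (∈-lookup)
open import Data.Product using (Σ; ∃-syntax; _×_; _,_; proj₁)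
open import Data.Product.Function.NonDependent.Propositional using (_×-⇔_)
open import Data.Sum using (inj₁; inj₂)
open import Data.Empty using (⊥-elim)
open import Function using (_∘_)
open import Function.Related.TypeIsomorphisms using (¬-cong-⇔)
open import Function.Bundles using (_⇔_; mk⇔; Equivalence)
open import Function.Definitions using (Injective)
import Function.Properties.Equivalence as ⇔
open import Relation.Nullary using (¬_; Dec; yes; no)
open import Relation.Nullary.Decidable using (_×-dec_; ¬?; decidable-stable)
open import Relation.Binary.PropositionalEquality using (_≡_; _≢_; refl; sym; trans; subst; cong)

-- Rainbow paths are short: with k vertex colours a rainbow path has at most
-- k internal vertices, hence length at most k + 1, and with k arc colours it
-- has length at most k. For k ≤ 2 every path shorter than that bound is
-- rainbow under any colouring, and whether two vertices are at distance 0, 1,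
-- 2 or at least 3 is decided by looking for an arc or a 2-step. So a rainbow
-- path can be replaced by a rainbow geodesic: either it already is one, or
-- the geodesic is short enough to be rainbow automatically. This gives
-- srvc = rvc and src = rc in the range 0, 1, 2. Finally, one vertex colour
-- suffices exactly when every pair is joined by a path of length ≤ 2, one arc
-- colour exactly when every pair is adjacent, and two arc colours still force
-- paths of length ≤ 2.

IsLeast-transfer : ∀ {P Q : ℕ → Set} {k} →
  (∀ {j} → j ≤ k → P j → Q j) → (∀ {j} → j ≤ k → Q j → P j) →
  IsLeast P k → IsLeast Q k
IsLeast-transfer {Q = Q} {k} P⇒Q Q⇒P (pk , least) = P⇒Q ≤-refl pk , leastQ
  where
  leastQ : ∀ j → Q j → k ≤ j
  leastQ j qj with ≤-total j k
  ... | inj₁ j≤k = least j (Q⇒P j≤k qj)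
  ... | inj₂ k≤j = k≤j

IsLeast-cong : ∀ {P Q : ℕ → Set} {k} → (∀ {j} → j ≤ k → P j ⇔ Q j) → IsLeast P k ⇔ IsLeast Q k
IsLeast-cong P⇔Q = mk⇔
  (IsLeast-transfer (λ j≤k → Equivalence.to (P⇔Q j≤k)) (λ j≤k → Equivalence.from (P⇔Q j≤k)))
  (IsLeast-transfer (λ j≤k → Equivalence.from (P⇔Q j≤k)) (λ j≤k → Equivalence.to (P⇔Q j≤k)))

IsLeast-zero : ∀ {P : ℕ → Set} → IsLeast P 0 ⇔ P 0
IsLeast-zero = mk⇔ proj₁ (λ p → p , λ _ _ → z≤n)

IsLeast-suc⇒¬ : ∀ {P : ℕ → Set} {k} → IsLeast P (suc k) → ¬ P k
IsLeast-suc⇒¬ {k = k} (_ , least) pk = 1+n≰n (least k pk)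

IsLeast-one : ∀ {P : ℕ → Set} → IsLeast P 1 ⇔ (P 1 × ¬ P 0)
IsLeast-one {P} = mk⇔ (λ l → proj₁ l , IsLeast-suc⇒¬ l) (λ (p₁ , ¬p₀) → p₁ , least ¬p₀)
  where
  least : ¬ P 0 → ∀ j → P j → 1 ≤ j
  least ¬p₀ zero p₀ = ⊥-elim (¬p₀ p₀)
  least ¬p₀ (suc j) _ = s≤s z≤n

lookup-injective : ∀ {A : Set} {xs : List A} → Unique xs → Injective _≡_ _≡_ (lookup xs)
lookup-injective {xs = _ ∷ _} _ {zero} {zero} _ = refl
lookup-injective {xs = _ ∷ _} (x∉xs ∷ _) {zero} {suc j} x≡xsⱼ = ⊥-elim (All.lookup x∉xs (∈-lookup j) x≡xsⱼ)
lookup-injective {xs = _ ∷ _} (x∉xs ∷ _) {suc i} {zero} xsᵢ≡x = ⊥-elim (All.lookup x∉xs (∈-lookup i) (sym xsᵢ≡x))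
lookup-injective {xs = _ ∷ _} (_ ∷ xs!) {suc i} {suc j} xsᵢ≡xsⱼ = cong suc (lookup-injective xs! xsᵢ≡xsⱼ)

Unique⇒length≤ : ∀ {k} {xs : List (Fin k)} → Unique xs → length xs ≤ k
Unique⇒length≤ xs! = injective⇒≤ (lookup-injective xs!)

len≤1+length-internal : ∀ {A : Set} (xs : List A) → len xs ≤ suc (length (internal xs))
len≤1+length-internal [] = z≤n
len≤1+length-internal (_ ∷ ys) = length≤1+length-dropLast ys
  where
  length≤1+length-dropLast : ∀ {A : Set} (ys : List A) → length ys ≤ suc (length (dropLast ys))
  length≤1+length-dropLast [] = z≤n
  length≤1+length-dropLast (_ ∷ []) = s≤s z≤n
  length≤1+length-dropLast (_ ∷ z ∷ zs) = s≤s (length≤1+length-dropLast (z ∷ zs))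

length-arcsOf : ∀ {A : Set} (xs : List A) → length (arcsOf xs) ≡ len xs
length-arcsOf [] = refl
length-arcsOf (_ ∷ []) = refl
length-arcsOf (_ ∷ y ∷ ys) = cong suc (length-arcsOf (y ∷ ys))

VRainbow⇒len≤ : ∀ {n k} (c : Fin n → Fin k) xs → VRainbow c xs → len xs ≤ suc k
VRainbow⇒len≤ c xs rainbow = ≤-trans (len≤1+length-internal xs)
  (s≤s (subst (_≤ _) (length-map c (internal xs)) (Unique⇒length≤ rainbow)))

ARainbow⇒len≤ : ∀ {n k} (c : Fin n → Fin n → Fin k) xs → ARainbow c xs → len xs ≤ k
ARainbow⇒len≤ c xs rainbow =
  subst (_≤ _) (trans (length-map _ (arcsOf xs)) (length-arcsOf xs)) (Unique⇒length≤ rainbow)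

len≤2⇒VRainbow : ∀ {n k} (c : Fin n → Fin k) xs → len xs ≤ 2 → VRainbow c xs
len≤2⇒VRainbow c [] _ = []
len≤2⇒VRainbow c (_ ∷ []) _ = []
len≤2⇒VRainbow c (_ ∷ _ ∷ []) _ = []
len≤2⇒VRainbow c (_ ∷ _ ∷ _ ∷ []) _ = [] ∷ []
len≤2⇒VRainbow c (_ ∷ _ ∷ _ ∷ _ ∷ _) (s≤s (s≤s ()))

len≤1⇒ARainbow : ∀ {n k} (c : Fin n → Fin n → Fin k) xs → len xs ≤ 1 → ARainbow c xs
len≤1⇒ARainbow c [] _ = []
len≤1⇒ARainbow c (_ ∷ []) _ = []
len≤1⇒ARainbow c (_ ∷ _ ∷ []) _ = [] ∷ []
len≤1⇒ARainbow c (_ ∷ _ ∷ _ ∷ _) (s≤s ())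

module _ {n : ℕ} (D : Digraph n) where

  arc? : ∀ u v → Dec (Arc D u v)
  arc? u v = Digraph.adj D u v Bool.≟ true

  Arc⇒≢ : ∀ {u v} → Arc D u v → u ≢ v
  Arc⇒≢ {u} uv refl with trans (sym uv) (Digraph.loopless D u)
  ... | ()

  TwoStep : Fin n → Fin n → Set
  TwoStep u v = ∃[ w ] Arc D u w × Arc D w v

  twoStep? : ∀ u v → Dec (TwoStep u v)
  twoStep? u v = any? (λ w → arc? u w ×-dec arc? w v)

  walk-len≥1 : ∀ {u v xs} → u ≢ v → IsWalk D u v xs → 1 ≤ len xs
  walk-len≥1 u≢v here = ⊥-elim (u≢v refl)
  walk-len≥1 u≢v (step _ here) = s≤s z≤n
  walk-len≥1 u≢v (step _ (step _ _)) = s≤s z≤n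

  walk-len≥2 : ∀ {u v xs} → u ≢ v → ¬ Arc D u v → IsWalk D u v xs → 2 ≤ len xs
  walk-len≥2 u≢v ¬uv here = ⊥-elim (u≢v refl)
  walk-len≥2 u≢v ¬uv (step uv here) = ⊥-elim (¬uv uv)
  walk-len≥2 u≢v ¬uv (step _ (step _ here)) = s≤s (s≤s z≤n)
  walk-len≥2 u≢v ¬uv (step _ (step _ (step _ _))) = s≤s (s≤s z≤n)

  walk-len≥3 : ∀ {u v xs} → u ≢ v → ¬ Arc D u v → ¬ TwoStep u v → IsWalk D u v xs → 3 ≤ len xs
  walk-len≥3 u≢v ¬uv ¬uwv here = ⊥-elim (u≢v refl)
  walk-len≥3 u≢v ¬uv ¬uwv (step uv here) = ⊥-elim (¬uv uv)
  walk-len≥3 u≢v ¬uv ¬uwv (step uw (step wv here)) = ⊥-elim (¬uwv (_ , uw , wv))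
  walk-len≥3 u≢v ¬uv ¬uwv (step _ (step _ (step _ here))) = s≤s (s≤s (s≤s z≤n))
  walk-len≥3 u≢v ¬uv ¬uwv (step _ (step _ (step _ (step _ _)))) = s≤s (s≤s (s≤s z≤n))

  trivial-geodesic : ∀ u → IsGeodesic D u u (u ∷ [])
  trivial-geodesic u = (here , [] ∷ []) , λ _ _ → z≤n

  arc-geodesic : ∀ {u v} → Arc D u v → IsGeodesic D u v (u ∷ v ∷ [])
  arc-geodesic uv =
    (step uv here , (Arc⇒≢ uv ∷ []) ∷ [] ∷ []) ,
    λ _ p → walk-len≥1 (Arc⇒≢ uv) (proj₁ p)

  twoStep-geodesic : ∀ {u w v} → u ≢ v → ¬ Arc D u v → Arc D u w → Arc D w v →
                     IsGeodesic D u v (u ∷ w ∷ v ∷ [])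
  twoStep-geodesic u≢v ¬uv uw wv =
    (step uw (step wv here) , (Arc⇒≢ uw ∷ u≢v ∷ []) ∷ (Arc⇒≢ wv ∷ []) ∷ [] ∷ []) ,
    λ _ p → walk-len≥2 u≢v ¬uv (proj₁ p)

  geodesic-≤3 : ∀ {u v xs} → IsPath D u v xs → len xs ≤ 3 →
                ∃[ ys ] IsGeodesic D u v ys × len ys ≤ len xs
  geodesic-≤3 {u} {v} {xs} p l with u ≟ v
  ... | yes refl = _ , trivial-geodesic u , z≤n
  ... | no u≢v with arc? u v
  ...   | yes uv = _ , arc-geodesic uv , walk-len≥1 u≢v (proj₁ p)
  ...   | no ¬uv with twoStep? u v
  ...     | yes (_ , uw , wv) = _ , twoStep-geodesic u≢v ¬uv uw wv , walk-len≥2 u≢v ¬uv (proj₁ p)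
  ...     | no ¬uwv = xs , (p , λ _ q → ≤-trans l (walk-len≥3 u≢v ¬uv ¬uwv (proj₁ q))) , ≤-refl

  minimal-path⇒geodesic : ∀ {u v xs ys} → IsGeodesic D u v ys → IsPath D u v xs →
                          len xs ≤ len ys → IsGeodesic D u v xs
  minimal-path⇒geodesic (_ , shortest) p xs≤ys = p , λ zs q → ≤-trans xs≤ys (shortest zs q)

  rainbow-geodesic : ∀ {u v xs m} (R : List (Fin n) → Set) → m ≤ 3 → (∀ {ys} → len ys < m → R ys) →
                     IsPath D u v xs → len xs ≤ m → R xs → ∃[ ys ] IsGeodesic D u v ys × R ys
  rainbow-geodesic {xs = xs} R m≤3 short p l r with geodesic-≤3 p (≤-trans l m≤3)
  ... | ys , g , ys≤xs with len xs ≤? len ys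
  ...   | yes xs≤ys = xs , minimal-path⇒geodesic g p xs≤ys , r
  ...   | no xs≰ys = ys , g , short (<-≤-trans (≰⇒> xs≰ys) l)

  Within : ℕ → Fin n → Fin n → Set
  Within ℓ u v = ∃[ xs ] IsPath D u v xs × len xs ≤ ℓ

  geodesic⇒Dist : ∀ {u v ys} → IsGeodesic D u v ys → Dist D u v (len ys)
  geodesic⇒Dist {ys = ys} (p , shortest) =
    (ys , p , refl) , λ { _ (zs , q , refl) → shortest zs q }

  Dist⇒≤ : ∀ {u v d ℓ} → Dist D u v d → Within ℓ u v → d ≤ ℓ
  Dist⇒≤ (_ , least) (xs , p , l) = ≤-trans (least (len xs) (xs , p , refl)) l

  Within⇒Dist : ∀ {u v ℓ} → ℓ ≤ 3 → Within ℓ u v → Σ ℕ λ d → Dist D u v d × d ≤ ℓ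
  Within⇒Dist ℓ≤3 (xs , p , l) with geodesic-≤3 p (≤-trans l ℓ≤3)
  ... | ys , g , ys≤xs = len ys , geodesic⇒Dist g , ≤-trans ys≤xs l

  Diam⇒Within : ∀ {m} → Diam D m → ∀ u v → Within m u v
  Diam⇒Within (bounded , _) u v with bounded u v
  ... | _ , ((xs , p , refl) , _) , l = xs , p , l

  IsComplete⇔Within1 : IsComplete D ⇔ (∀ u v → Within 1 u v)
  IsComplete⇔Within1 = mk⇔ complete⇒within within⇒complete
    where
    complete⇒within : IsComplete D → ∀ u v → Within 1 u v
    complete⇒within complete u v with u ≟ v
    ... | yes refl = _ , proj₁ (trivial-geodesic u) , z≤n
    ... | no u≢v = _ , proj₁ (arc-geodesic (complete u v u≢v)) , ≤-refl
    within⇒complete : (∀ u v → Within 1 u v) → IsComplete D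
    within⇒complete within u v u≢v with arc? u v
    ... | yes uv = uv
    ... | no ¬uv with within u v
    ...   | _ , p , l = ⊥-elim (1+n≰n (≤-trans (walk-len≥2 u≢v ¬uv (proj₁ p)) l))

  IsComplete⇔Diam1 : ∀ {u₀ u₁} → u₀ ≢ u₁ → IsComplete D ⇔ Diam D 1
  IsComplete⇔Diam1 u₀≢u₁ = mk⇔
    (λ complete →
      (λ u v → Within⇒Dist (s≤s z≤n) (Equivalence.to IsComplete⇔Within1 complete u v)) ,
      (_ , _ , geodesic⇒Dist (arc-geodesic (complete _ _ u₀≢u₁))))
    (λ diam → Equivalence.from IsComplete⇔Within1 (Diam⇒Within diam))

  ¬IsComplete⇒nonadjacent : ¬ IsComplete D → Σ (Fin n) λ u → Σ (Fin n) λ v → u ≢ v × ¬ Arc D u v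
  ¬IsComplete⇒nonadjacent ¬complete
    with any? (λ u → any? (λ v → ¬? (u ≟ v) ×-dec ¬? (arc? u v)))
  ... | yes witness = witness
  ... | no none = ⊥-elim (¬complete λ u v u≢v →
          decidable-stable (arc? u v) (λ ¬uv → none (u , v , u≢v , ¬uv)))

  Diam2⇔ : Diam D 2 ⇔ ((∀ u v → Within 2 u v) × ¬ IsComplete D)
  Diam2⇔ = mk⇔
    (λ diam@(_ , (u , v , d₂)) → Diam⇒Within diam , λ complete →
      1+n≰n (Dist⇒≤ d₂ (Equivalence.to IsComplete⇔Within1 complete u v)))
    (λ (within , ¬complete) →
      (λ u v → Within⇒Dist (s≤s (s≤s z≤n)) (within u v)) , far-pair within ¬complete)
    where
    far-pair : (∀ u v → Within 2 u v) → ¬ IsComplete D →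
               Σ (Fin n) λ u → Σ (Fin n) λ v → Dist D u v 2
    far-pair within ¬complete with ¬IsComplete⇒nonadjacent ¬complete
    ... | u , v , u≢v , ¬uv with within u v
    ...   | xs , p , l = u , v , subst (Dist D u v) (≤-antisym l (walk-len≥2 u≢v ¬uv (proj₁ p)))
                                  (geodesic⇒Dist (p , λ _ q → ≤-trans l (walk-len≥2 u≢v ¬uv (proj₁ q))))

  SRVColourable⇔RVColourable : ∀ {k} → k ≤ 2 → SRVColourable D k ⇔ RVColourable D k
  SRVColourable⇔RVColourable {k} k≤2 = mk⇔ forget strengthen
    where
    forget : SRVColourable D k → RVColourable D k
    forget (inj₁ complete) = inj₁ complete
    forget (inj₂ (c , geodesics)) = inj₂ (c , λ u v →
      let xs , g , r = geodesics u v in xs , proj₁ g , r)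
    strengthen : RVColourable D k → SRVColourable D k
    strengthen (inj₁ complete) = inj₁ complete
    strengthen (inj₂ (c , paths)) = inj₂ (c , λ u v →
      let xs , p , r = paths u v in
      rainbow-geodesic (VRainbow c) (s≤s k≤2) (λ {ys} l → len≤2⇒VRainbow c ys (≤-trans (≤-pred l) k≤2))
                       p (VRainbow⇒len≤ c xs r) r)

  SRColourable⇔RColourable : ∀ {k} → k ≤ 2 → SRColourable D k ⇔ RColourable D k
  SRColourable⇔RColourable {k} k≤2 = mk⇔ forget strengthen
    where
    forget : SRColourable D k → RColourable D k
    forget (c , geodesics) = c , λ u v → let xs , g , r = geodesics u v in xs , proj₁ g , r
    strengthen : RColourable D k → SRColourable D k
    strengthen (c , paths) = c , λ u v →
      let xs , p , r = paths u v in
      rainbow-geodesic (ARainbow c) (≤-trans k≤2 (n≤1+n 2))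
                       (λ {ys} l → len≤1⇒ARainbow c ys (≤-pred (≤-trans l k≤2)))
                       p (ARainbow⇒len≤ c xs r) r

  SRVC⇔RVC : ∀ {k} → k ≤ 2 → SRVC D k ⇔ RVC D k
  SRVC⇔RVC k≤2 = IsLeast-cong (λ j≤k → SRVColourable⇔RVColourable (≤-trans j≤k k≤2))

  SRC⇔RC : ∀ {k} → k ≤ 2 → SRC D k ⇔ RC D k
  SRC⇔RC k≤2 = IsLeast-cong (λ j≤k → SRColourable⇔RColourable (≤-trans j≤k k≤2))

  RVColourable⇒Within : ∀ {k} → RVColourable D k → ∀ u v → Within (suc k) u v
  RVColourable⇒Within (inj₁ (refl , complete)) = Equivalence.to IsComplete⇔Within1 complete
  RVColourable⇒Within (inj₂ (c , paths)) u v = let xs , p , r = paths u v in xs , p , VRainbow⇒len≤ c xs r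

  RColourable⇒Within : ∀ {k} → RColourable D k → ∀ u v → Within k u v
  RColourable⇒Within (c , paths) u v = let xs , p , r = paths u v in xs , p , ARainbow⇒len≤ c xs r

  RVColourable0⇔IsComplete : Fin n → RVColourable D 0 ⇔ IsComplete D
  RVColourable0⇔IsComplete x = mk⇔ complete (λ K → inj₁ (refl , K))
    where
    complete : RVColourable D 0 → IsComplete D
    complete (inj₁ (_ , K)) = K
    complete (inj₂ (c , _)) with c x
    ... | ()

  RVColourable1⇔Within2 : RVColourable D 1 ⇔ (∀ u v → Within 2 u v)
  RVColourable1⇔Within2 = mk⇔ RVColourable⇒Within λ within → inj₂ ((λ _ → zero) , λ u v →
    let xs , p , l = within u v in xs , p , len≤2⇒VRainbow _ xs l)

  ¬RColourable0 : Fin n → ¬ RColourable D 0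
  ¬RColourable0 x (c , _) with c x x
  ... | ()

  RColourable1⇔Within1 : RColourable D 1 ⇔ (∀ u v → Within 1 u v)
  RColourable1⇔Within1 = mk⇔ RColourable⇒Within λ within → (λ _ _ → zero) , λ u v →
    let xs , p , l = within u v in xs , p , len≤1⇒ARainbow _ xs l

  IsComplete⇔RVC0 : Fin n → IsComplete D ⇔ RVC D 0
  IsComplete⇔RVC0 x = ⇔.sym (⇔.trans IsLeast-zero (RVColourable0⇔IsComplete x))

  IsComplete⇔RC1 : Fin n → IsComplete D ⇔ RC D 1
  IsComplete⇔RC1 x = mk⇔
    (λ complete → Equivalence.from IsLeast-one (colourable complete , ¬RColourable0 x))
    (λ rc → Equivalence.from IsComplete⇔Within1 (RColourable⇒Within (proj₁ rc)))
    where
    colourable : IsComplete D → RColourable D 1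
    colourable = Equivalence.from RColourable1⇔Within1 ∘ Equivalence.to IsComplete⇔Within1

  RVC1⇔Diam2 : Fin n → RVC D 1 ⇔ Diam D 2
  RVC1⇔Diam2 x = ⇔.trans IsLeast-one
    (⇔.trans (RVColourable1⇔Within2 ×-⇔ ¬-cong-⇔ (RVColourable0⇔IsComplete x)) (⇔.sym Diam2⇔))

  RC2⇒Diam2 : RC D 2 → Diam D 2
  RC2⇒Diam2 rc = Equivalence.from Diam2⇔
    ( RColourable⇒Within (proj₁ rc)
    , λ complete → IsLeast-suc⇒¬ rc (Equivalence.from RColourable1⇔Within1
                                       (Equivalence.to IsComplete⇔Within1 complete)) )

theorem2 : ∀ (n : ℕ) (D : Digraph n) → 2 ≤ n → StronglyConnected D →
    ( (IsComplete D ⇔ Diam D 1)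
      × (IsComplete D ⇔ SRVC D 0)
      × (IsComplete D ⇔ RVC D 0)
      × (IsComplete D ⇔ SRC D 1)
      × (IsComplete D ⇔ RC D 1) )
    × ( ((SRVC D 1 ⇔ RVC D 1) × (RVC D 1 ⇔ Diam D 2))
      × (SRVC D 2 ⇔ RVC D 2)
      × (SRC D 2 ⇔ RC D 2)
      × (SRC D 2 → SRVC D 1 × RVC D 1 × Diam D 2)
      × (RC D 2 → SRVC D 1 × RVC D 1 × Diam D 2) )
theorem2 _ D (s≤s (s≤s _)) _ =
  ( IsComplete⇔Diam1 D {zero} {suc zero} (λ ())
  , ⇔.trans (IsComplete⇔RVC0 D zero) (⇔.sym (SRVC⇔RVC D z≤n))
  , IsComplete⇔RVC0 D zero
  , ⇔.trans (IsComplete⇔RC1 D zero) (⇔.sym (SRC⇔RC D (s≤s z≤n)))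
  , IsComplete⇔RC1 D zero )
  , ( (SRVC⇔RVC D (s≤s z≤n) , RVC1⇔Diam2 D zero)
    , SRVC⇔RVC D ≤-refl
    , SRC⇔RC D ≤-refl
    , diam2-consequences ∘ RC2⇒Diam2 D ∘ Equivalence.to (SRC⇔RC D ≤-refl)
    , diam2-consequences ∘ RC2⇒Diam2 D )
  where
  diam2-consequences : Diam D 2 → SRVC D 1 × RVC D 1 × Diam D 2
  diam2-consequences diam =
    Equivalence.from (SRVC⇔RVC D (s≤s z≤n)) rvc₁ , rvc₁ , diam
    where
    rvc₁ : RVC D 1
    rvc₁ = Equivalence.from (RVC1⇔Diam2 D zero) diam
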